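{- Let $L$ be a finite lattice with join-presentation $(J(L),\leq,\mathcal{M})$. Let $j,k \in J(L)$ and let $C \subseteq J(L)$ be a $\leq$-antichain such that $C \in \mathcal{M}(j)$ and $k \in C$. Then: 1. $j \notin \overline{{\downarrow}(C \setminus \{k\})}$; 2. $k \notin \overline{{\downarrow}(C \setminus \{k\})}$; 3. $j \notin \{k' \in J(L) \mid k' < k\}$; 4. there is no $D \in \mathcal{M}(j)$ such that $D \subseteq \overline{{\downarrow}(C \setminus \{k\})} \cup \{k' \in J(L) \mid k' < k\}$. Here ${\downarrow}$ is taken in the poset $(J(L),\leq)$ and $\overline{S}$ denotes the closure of a downset $S$ of $(J(L),\leq)$ defined below.
   Context: For a finite lattice $L$, $J(L)$ is its set of join-irreducible elements (elements $j \neq \bot$ such that $j = a \vee b$ implies $j = a$ or $j = b$), ordered by the order of $L$. For subsets $A,B$ of a poset, $A \ll B$ means every $a \in A$ lies below some $b \in B$. A subset $C \subseteq L$ is a join-cover of $a \in L$ if $a \leq \bigvee C$; it is a minimal join-cover of $a$ if it is a $\leq$-antichain join-cover of $a$ such that for every $\leq$-antichain $D \subseteq L$, if $a \leq \bigvee D$ and $D \ll C$ then $D = C$. (Minimal join-covers consist of join-irreducible elements.) The join-presentation of $L$ is $(J(L),\leq,\mathcal{M})$ where $\mathcal{M}(j)$ is the collection of minimal join-covers of $j$, for $j \in J(L)$. For a downset $S$ of $(J(L),\leq)$, its closure is $\overline{S} := \{x \in J(L) \mid D \subseteq S \text{ for some } D \in \mathcal{M}(x)\}$. For $x \in J(L)$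 and $C\subseteq J(L)$, ${\downarrow}C = \{x \in J(L) \mid x \leq c \text{ for some } c \in C\}$. -}

module Defs where

open import Level using (0ℓ)
open import Algebra.Core using (Op₂)
open import Data.Product using (Σ; ∃; _×_; _,_)
open import Data.Sum using (_⊎_)
open import Data.List using (List)
open import Data.List.Membership.Propositional using (_∈_)
open import Relation.Nullary using (¬_)
open import Relation.Unary using (Pred; _⊆_; _∪_)
open import Relation.Binary using (Rel)
open import Relation.Binary.PropositionalEquality using (_≡_; _≢_)
open import Relation.Binary.Lattice.Structures using (IsBoundedLattice)

-- A finite lattice: a (bounded) order-theoretic lattice whose equality is
-- propositional equality, together with a finite enumeration of its elements.
-- (A finite nonempty lattice always has a bottom and a top.)
record FiniteLattice : Set₁ where
  field
    Carrier          : Set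
    _≤_              : Rel Carrier 0ℓ
    _∨_              : Op₂ Carrier
    _∧_              : Op₂ Carrier
    ⊤                : Carrier
    ⊥                : Carrier
    isBoundedLattice : IsBoundedLattice _≡_ _≤_ _∨_ _∧_ ⊤ ⊥
    elements         : List Carrier
    enumerates       : ∀ x → x ∈ elements

Subset : Set → Set₁
Subset A = Pred A 0ℓ

module JoinPresentation (L : FiniteLattice) where
  open FiniteLattice L

  _<_ : Carrier → Carrier → Set
  x < y = x ≤ y × x ≢ y

  IsJoinIrreducible : Carrier → Set
  IsJoinIrreducible j = j ≢ ⊥ × (∀ a b → j ≡ a ∨ b → j ≡ a ⊎ j ≡ b)

  -- a ≤ ⋁ C, where ⋁ C is the least upper bound of C
  -- (exists since L is finite): a lies below every upper bound of C.
  _≤⋁_ : Carrier → Subset Carrier → Set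
  a ≤⋁ C = ∀ u → (∀ c → C c → c ≤ u) → a ≤ u

  Antichain : Subset Carrier → Set
  Antichain C = ∀ x y → C x → C y → x ≤ y → x ≡ y

  _≪_ : Subset Carrier → Subset Carrier → Set
  A ≪ B = ∀ a → A a → ∃ λ b → B b × a ≤ b

  _≐_ : Subset Carrier → Subset Carrier → Set
  A ≐ B = (A ⊆ B) × (B ⊆ A)

  IsMinimalJoinCover : Carrier → Subset Carrier → Set₁
  IsMinimalJoinCover a C =
    Antichain C × a ≤⋁ C ×
    (∀ (D : Subset Carrier) → Antichain D → a ≤⋁ D → D ≪ C → D ≐ C)

  𝓜 : Carrier → Subset Carrier → Set₁
  𝓜 j C = IsMinimalJoinCover j C

  ↓ : Subset Carrier → Subset Carrier
  ↓ C x = IsJoinIrreducible x × ∃ λ c → C c × x ≤ c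

  _∖⟨_⟩ : Subset Carrier → Carrier → Subset Carrier
  (C ∖⟨ k ⟩) x = C x × x ≢ k

  closure : Subset Carrier → Pred Carrier (Level.suc 0ℓ)
  closure S x = IsJoinIrreducible x × Σ (Subset Carrier) (λ D → 𝓜 x D × D ⊆ S)

  strictlyBelowJ : Carrier → Subset Carrier
  strictlyBelowJ k k' = IsJoinIrreducible k' × k' < k

-- The only property of a minimal join-cover C of j that is used: whenever an
-- antichain D with j ≤ ⋁ D refines C (D ≪ C), it already contains C.
-- Each part produces such a D that misses k: C ∖ {k} itself (parts 1, 2),
-- the singleton {j} (part 3), and, for part 4, C ∖ {k} together with those
-- elements of the other cover that lie strictly below k and below no element of
-- C ∖ {k}.  Splitting elements by such properties needs excluded middle, which
-- is available under a double negation because the lattice is finite.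
module Submission where

open import Defs
open import Level using (Level)
open import Data.Product using (Σ; _×_; _,_; proj₁; proj₂)
open import Data.Sum using (_⊎_; inj₁; inj₂)
open import Data.Empty using (⊥-elim)
open import Data.List using (List; []; _∷_)
open import Data.List.Membership.Propositional using (_∈_)
open import Data.List.Relation.Unary.Any using (here; there)
open import Relation.Nullary using (¬_; Dec; yes; no)
open import Relation.Nullary.Decidable using (¬¬-excluded-middle)
open import Relation.Unary using (Pred; _⊆_; _∪_)
open import Relation.Binary.PropositionalEquality using (_≡_; refl; sym)
open import Relation.Binary.Lattice.Structures using (IsBoundedLattice)

private
  variable
    a p : Level
    A : Set a

¬¬-decidableOn : (P : Pred A p) (xs : List A) → ¬ ¬ (∀ x → x ∈ xs → Dec (P x))
¬¬-decidableOn P [] ¬dec = ¬dec λ _ ()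
¬¬-decidableOn P (y ∷ ys) ¬dec =
  ¬¬-excluded-middle λ P?y → ¬¬-decidableOn P ys λ P?ys →
    ¬dec λ { x (here refl) → P?y ; x (there x∈ys) → P?ys x x∈ys }

module _ (L : FiniteLattice) where
  open FiniteLattice L
  open JoinPresentation L
  open IsBoundedLattice isBoundedLattice using (trans) renaming (refl to ≤-refl)

  ¬¬-decidable : (P : Pred Carrier p) → ¬ ¬ (∀ x → Dec (P x))
  ¬¬-decidable P ¬dec = ¬¬-decidableOn P elements λ dec → ¬dec λ x → dec x (enumerates x)

  ∈⇒≤⋁ : ∀ {x B} → B x → x ≤⋁ B
  ∈⇒≤⋁ Bx u ub = ub _ Bx

  ≤∈⇒≤⋁ : ∀ {x y B} → x ≤ y → B y → x ≤⋁ B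
  ≤∈⇒≤⋁ x≤y By u ub = trans x≤y (ub _ By)

  ≤⋁-trans : ∀ {x B A} → x ≤⋁ B → (∀ b → B b → b ≤⋁ A) → x ≤⋁ A
  ≤⋁-trans x≤⋁B B≤⋁A u ub = x≤⋁B u (λ b Bb → B≤⋁A b Bb u ub)

  closure-↓⇒≤⋁ : ∀ {x B} → closure (↓ B) x → x ≤⋁ B
  closure-↓⇒≤⋁ (_ , D , (_ , x≤⋁D , _) , D⊆↓B) =
    ≤⋁-trans x≤⋁D λ d Dd → let (_ , b , Bb , d≤b) = D⊆↓B Dd in ≤∈⇒≤⋁ d≤b Bb

  antichain-∖ : ∀ {C} k → Antichain C → Antichain (C ∖⟨ k ⟩)
  antichain-∖ k C-anti x y (Cx , _) (Cy , _) = C-anti x y Cx Cy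

  ⊆⇒≪ : ∀ {B C} → B ⊆ C → B ≪ C
  ⊆⇒≪ B⊆C b Bb = b , B⊆C Bb , ≤-refl

  minimal⇒⊆ : ∀ {j C D} → 𝓜 j C → Antichain D → j ≤⋁ D → D ≪ C → C ⊆ D
  minimal⇒⊆ (_ , _ , minimal) D-anti j≤⋁D D≪C = proj₂ (minimal _ D-anti j≤⋁D D≪C)

  module _ {j k C} (M : 𝓜 j C) (Ck : C k) where

    minimal-¬≤⋁∖ : ¬ j ≤⋁ (C ∖⟨ k ⟩)
    minimal-¬≤⋁∖ j≤⋁C∖k = proj₂ (C⊆C∖k Ck) refl
      where
      C⊆C∖k : C ⊆ C ∖⟨ k ⟩
      C⊆C∖k = minimal⇒⊆ M (antichain-∖ k (proj₁ M)) j≤⋁C∖k (⊆⇒≪ {C ∖⟨ k ⟩} proj₁)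

    minimal-¬<member : ¬ j < k
    minimal-¬<member (j≤k , j≢k) = j≢k (sym (C⊆⟨j⟩ Ck))
      where
      C⊆⟨j⟩ : C ⊆ (_≡ j)
      C⊆⟨j⟩ = minimal⇒⊆ {D = _≡ j} M (λ { _ _ refl refl _ → refl }) (∈⇒≤⋁ refl)
                          (λ { _ refl → k , Ck , j≤k })

    -- k covered by C ∖ {k} makes C ∖ {k} a cover of j.
    minimal-¬member≤⋁∖ : ¬ k ≤⋁ (C ∖⟨ k ⟩)
    minimal-¬member≤⋁∖ k≤⋁C∖k = ¬¬-decidable (_≡ k) λ ≟k →
      minimal-¬≤⋁∖ (≤⋁-trans (proj₁ (proj₂ M)) λ c Cc → cover ≟k c Cc)
      where
      cover : (∀ x → Dec (x ≡ k)) → ∀ c → C c → c ≤⋁ (C ∖⟨ k ⟩)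
      cover ≟k c Cc with ≟k c
      ... | yes refl = k≤⋁C∖k
      ... | no c≢k   = ∈⇒≤⋁ (Cc , c≢k)

    module Refine {D} (D-anti : Antichain D) (j≤⋁D : j ≤⋁ D)
             (D⊆ : D ⊆ (closure (↓ (C ∖⟨ k ⟩)) ∪ strictlyBelowJ k)) where

      BelowC∖k : Pred Carrier _
      BelowC∖k d = Σ Carrier λ c → (C ∖⟨ k ⟩) c × d ≤ c

      Refinement : Pred Carrier _
      Refinement x = (C ∖⟨ k ⟩) x ⊎ (D x × x < k × ¬ BelowC∖k x)

      refinement-antichain : Antichain Refinement
      refinement-antichain x y (inj₁ C∖k-x) (inj₁ C∖k-y) =
        antichain-∖ k (proj₁ M) x y C∖k-x C∖k-y
      refinement-antichain x y (inj₁ (Cx , x≢k)) (inj₂ (_ , (y≤k , _) , _)) x≤y =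
        ⊥-elim (x≢k (proj₁ M x k Cx Ck (trans x≤y y≤k)))
      refinement-antichain x y (inj₂ (_ , _ , ¬below)) (inj₁ C∖k-y) x≤y =
        ⊥-elim (¬below (y , C∖k-y , x≤y))
      refinement-antichain x y (inj₂ (Dx , _)) (inj₂ (Dy , _)) = D-anti x y Dx Dy

      refinement-≪ : Refinement ≪ C
      refinement-≪ x (inj₁ (Cx , _))            = x , Cx , ≤-refl
      refinement-≪ x (inj₂ (_ , (x≤k , _) , _)) = k , Ck , x≤k

      refinement-covers : (∀ x → Dec (BelowC∖k x)) → j ≤⋁ Refinement
      refinement-covers below? = ≤⋁-trans j≤⋁D cover
        where
        cover : ∀ d → D d → d ≤⋁ Refinement
        cover d Dd with D⊆ Dd | below? d
        ... | inj₁ d∈closure | _ =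
          ≤⋁-trans (closure-↓⇒≤⋁ d∈closure) λ c C∖k-c → ∈⇒≤⋁ (inj₁ C∖k-c)
        ... | inj₂ _ | yes (c , C∖k-c , d≤c) = ≤∈⇒≤⋁ d≤c (inj₁ C∖k-c)
        ... | inj₂ (_ , d<k) | no ¬below = ∈⇒≤⋁ (inj₂ (Dd , d<k , ¬below))

      refinement-∌k : ¬ Refinement k
      refinement-∌k (inj₁ (_ , k≢k))          = k≢k refl
      refinement-∌k (inj₂ (_ , (_ , k≢k) , _)) = k≢k refl

    minimal-¬cover⊆closure∪below :
      ¬ Σ (Subset Carrier) (λ D → 𝓜 j D × D ⊆ (closure (↓ (C ∖⟨ k ⟩)) ∪ strictlyBelowJ k))
    minimal-¬cover⊆closure∪below (D , (D-anti , j≤⋁D , _) , D⊆) =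
      ¬¬-decidable BelowC∖k λ below? →
        refinement-∌k (minimal⇒⊆ M refinement-antichain (refinement-covers below?) refinement-≪ Ck)
      where open Refine D-anti j≤⋁D D⊆

mainTheorem2 : (L : FiniteLattice) →
    let open FiniteLattice L
        open JoinPresentation L
    in (j k : Carrier) (C : Subset Carrier) →
       IsJoinIrreducible j → IsJoinIrreducible k →
       C ⊆ IsJoinIrreducible → Antichain C → 𝓜 j C → C k →
       (¬ closure (↓ (C ∖⟨ k ⟩)) j)
       × (¬ closure (↓ (C ∖⟨ k ⟩)) k)
       × (¬ strictlyBelowJ k j)
       × (¬ Σ (Subset Carrier) (λ D → 𝓜 j D × D ⊆ (closure (↓ (C ∖⟨ k ⟩)) ∪ strictlyBelowJ k)))
mainTheorem2 L j k C _ _ _ _ M Ck =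
    (λ j∈closure → minimal-¬≤⋁∖ L M Ck (closure-↓⇒≤⋁ L j∈closure))
  , (λ k∈closure → minimal-¬member≤⋁∖ L M Ck (closure-↓⇒≤⋁ L k∈closure))
  , (λ (_ , j<k) → minimal-¬<member L M Ck j<k)
  , minimal-¬cover⊆closure∪below L M Ck
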